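{- Let $K(v)$ be a complete multipartite graph and $E$ a set of edges of $K(v)$. If $\langle E\rangle$ contains two distinct $\Xi_2$-subgraphs, then the number of garlands does not exceed $2^{|E|-1} + 2^{|E|-3} - 1$.
   Context: All graphs are finite and simple. For a sequence $v=(v_1,\dots,v_t)$ of positive integers, $K(v)$ is the complete $t$-partite graph with parts $V_1,\dots,V_t$, $|V_i|=v_i$. $\langle E\rangle$ is the subgraph of $K(v)$ consisting of the edges of $E$ and their endpoints. An $E$-subgraph is a subgraph $G_1$ of $K(v)$ which is a complete multipartite graph (with at least two nonempty parts) such that every part of $G_1$ is contained in some part of $K(v)$ and every edge of $G_1$ belongs to $E$. A garland is a nonempty set of pairwise vertex-disjoint $E$-subgraphs. A $\Xi_2$-subgraph is the subgraph formed by two edges $e_1,e_2\in E$ lying in a triangle of $K(v)$ whose third edge is not in $E$ (i.e. a triangle of $K(v)$ with exactly two edges in $E$). -}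

module Defs where

open import Data.Nat using (ℕ; _≤_; _∸_; _+_; _^_)
open import Data.Fin as Fin using (Fin)
open import Data.Bool using (Bool; true; false; _∧_; _∨_)
open import Data.Product using (Σ; ∃; ∃-syntax; _×_; _,_; proj₁; proj₂)
open import Data.Product.Properties using (≡-dec)
open import Data.Sum using (_⊎_)
open import Data.List using (List; []; _∷_; length)
open import Data.List.Relation.Unary.All using (All)
open import Data.List.Relation.Unary.Any using (Any)
open import Data.List.Relation.Unary.AllPairs using (AllPairs)
open import Data.List.Membership.Propositional using (_∈_)
open import Relation.Nullary using (¬_; Dec)
open import Relation.Nullary.Decidable using (⌊_⌋)
open import Relation.Binary.PropositionalEquality using (_≡_; _≢_)
open import Function.Bundles using (_⇔_)

-- The complete t-partite graph K(v): parts V_i = {i} × Fin (v i).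
-- Two vertices are adjacent in K(v) iff they lie in different parts.
Vertex : ∀ {t} → (Fin t → ℕ) → Set
Vertex {t} v = Σ (Fin t) (λ i → Fin (v i))

part : ∀ {t} {v : Fin t → ℕ} → Vertex v → Fin t
part = proj₁

_≟V_ : ∀ {t} {v : Fin t → ℕ} → (x y : Vertex v) → Dec (x ≡ y)
_≟V_ = ≡-dec Fin._≟_ Fin._≟_

_==_ : ∀ {t} {v : Fin t → ℕ} → Vertex v → Vertex v → Bool
x == y = ⌊ x ≟V y ⌋

-- Edges are listed as pairs (a , b); an edge is the unordered pair {a , b}.
SameEdge : ∀ {t} {v : Fin t → ℕ} → Vertex v × Vertex v → Vertex v × Vertex v → Set
SameEdge (a , b) (c , d) = (a ≡ c × b ≡ d) ⊎ (a ≡ d × b ≡ c)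

-- E is a set of edges of K(v): every listed pair is an edge of K(v)
-- (endpoints in different parts) and no edge is listed twice.
-- |E| is then  length E.
IsEdgeSet : ∀ {t} {v : Fin t → ℕ} → List (Vertex v × Vertex v) → Set
IsEdgeSet E = All (λ e → part (proj₁ e) ≢ part (proj₂ e)) E
            × AllPairs (λ e e′ → ¬ SameEdge e e′) E

InE : ∀ {t} {v : Fin t → ℕ} → List (Vertex v × Vertex v) → Vertex v → Vertex v → Set
InE E a b = ((a , b) ∈ E) ⊎ ((b , a) ∈ E)

record Graph {t} (v : Fin t → ℕ) : Set where
  field
    vs : Vertex v → Bool
    es : Vertex v → Vertex v → Bool
open Graph public

_≈G_ : ∀ {t} {v : Fin t → ℕ} → Graph v → Graph v → Set
G ≈G H = (∀ x → vs G x ≡ vs H x) × (∀ x y → es G x y ≡ es H x y)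

-- The parts of G are the classes of the
-- labelling lab restricted to the vertex set of G.
IsESubgraph : ∀ {t} {v : Fin t → ℕ} → List (Vertex v × Vertex v) → Graph v → Set
IsESubgraph {v = v} E G =
    (∀ x y → es G x y ≡ true → (vs G x ≡ true × vs G y ≡ true × InE E x y))
  × (Σ (Vertex v → ℕ) λ lab → (
       (∀ x y → vs G x ≡ true → vs G y ≡ true →
          (es G x y ≡ true ⇔ lab x ≢ lab y))
     × (∀ x y → vs G x ≡ true → vs G y ≡ true → lab x ≡ lab y → part x ≡ part y)
     × (∃[ x ] ∃[ y ] (vs G x ≡ true × vs G y ≡ true × lab x ≢ lab y))))

ESubgraph : ∀ {t} {v : Fin t → ℕ} → List (Vertex v × Vertex v) → Set
ESubgraph {v = v} E = Σ (Graph v) (IsESubgraph E)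

VertexDisjoint : ∀ {t} {v : Fin t → ℕ} → Graph v → Graph v → Set
VertexDisjoint G H = ∀ x → vs G x ≡ true → vs H x ≡ true → Data.Empty.⊥
  where import Data.Empty

-- A garland: a nonempty finite set of pairwise vertex-disjoint E-subgraphs,
-- given as a list without repetitions (repetitions are excluded by
-- disjointness since E-subgraphs have nonempty vertex sets).
record Garland {t} {v : Fin t → ℕ} (E : List (Vertex v × Vertex v)) : Set where
  field
    members  : List (ESubgraph E)
    nonempty : members ≢ []
    disjoint : AllPairs (λ G H → VertexDisjoint (proj₁ G) (proj₁ H)) members
open Garland public

InGarland : ∀ {t} {v : Fin t → ℕ} {E : List (Vertex v × Vertex v)} →
            Graph v → Garland E → Set
InGarland G g = Any (λ H → proj₁ H ≈G G) (members g)

SameGarland : ∀ {t} {v : Fin t → ℕ} {E : List (Vertex v × Vertex v)} →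
              Garland E → Garland E → Set
SameGarland g h = ∀ G → (InGarland G g ⇔ InGarland G h)

pairEq : ∀ {t} {v : Fin t → ℕ} → Vertex v → Vertex v → Vertex v → Vertex v → Bool
pairEq a b c d = (a == c ∧ b == d) ∨ (a == d ∧ b == c)

pathGraph : ∀ {t} {v : Fin t → ℕ} → Vertex v → Vertex v → Vertex v → Graph v
vs (pathGraph x y z) w = (w == x) ∨ (w == y) ∨ (w == z)
es (pathGraph x y z) a b = pairEq a b x y ∨ pairEq a b y z

-- x, y, z span a triangle of K(v) (pairwise different parts) with exactly
-- the two edges {x,y}, {y,z} in E; pathGraph x y z is then a Ξ₂-subgraph.
IsXi2 : ∀ {t} {v : Fin t → ℕ} → List (Vertex v × Vertex v) →
        Vertex v → Vertex v → Vertex v → Set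
IsXi2 E x y z = part x ≢ part y × part y ≢ part z × part x ≢ part z
              × InE E x y × InE E y z × ¬ InE E x z

TwoDistinctXi2 : ∀ {t} {v : Fin t → ℕ} → List (Vertex v × Vertex v) → Set
TwoDistinctXi2 {v = v} E =
  ∃[ x ] ∃[ y ] ∃[ z ] ∃[ x′ ] ∃[ y′ ] ∃[ z′ ]
    (IsXi2 {v = v} E x y z × IsXi2 E x′ y′ z′
     × ¬ (pathGraph x y z ≈G pathGraph x′ y′ z′))

module Submission where

-- Encode a garland g by its word: for each edge of E (in a fixed listing)
-- whether some member of g contains it.  (1) The word determines the
-- garland (agree⇒same): each member is a connected graph, recovered from
-- any of its edges by following edges, and disjointness pins down which
-- member owns an edge.  (2) The word is not all-false, as a garland carries
-- an edge.  (3) The two edges xy, yz of a Ξ₂-subgraph are never carried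
-- together: they would lie in one member, which would then join x and z
-- (xi2-conflict).  Two distinct Ξ₂-subgraphs give two different exclusive
-- pairs of edges, either sharing an edge (three edges, 5 of 8 patterns
-- allowed) or disjoint (four edges, 9 of 16).  Counting the admissible
-- words, including the all-false one, gives 5 · 2^(|E|-3), resp.
-- 9 · 2^(|E|-4) ≤ 2^(|E|-1) + 2^(|E|-3).

open import Defs
open import Data.Nat using (ℕ; _≤_; _∸_; _+_; _^_; _*_; suc; z≤n; s≤s)
import Data.Nat.Properties as ℕP
open import Data.Fin using (Fin)
open import Data.List using (List; []; _∷_; _++_; length; map; filter; cartesianProductWith)
open import Data.List.Properties using (length-++; length-map; map-++; ∷-injective)
open import Data.List.Relation.Unary.All as All using (All; []; _∷_)
import Data.List.Relation.Unary.All.Properties as AllP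
open import Data.List.Relation.Unary.AllPairs as AllPairs using (AllPairs; []; _∷_)
import Data.List.Relation.Unary.AllPairs.Properties as AllPairsP
open import Data.List.Relation.Unary.Any using (here; there)
open import Data.List.Membership.Propositional using (_∈_; find; lose)
open import Data.List.Membership.Propositional.Properties
  using (∈-cartesianProductWith⁺; ∈-filter⁺; ∈-map⁻)
open import Data.Product using (_×_; ∃-syntax; _,_; proj₁; proj₂)
open import Data.Product.Properties using (≡-dec)
open import Data.Sum using (_⊎_; inj₁; inj₂)
open import Data.Bool using (Bool; true; false; T; not; _∧_; _∨_)
open import Data.Bool.Properties using (∨-comm; T-∧; ⇔→≡)
open import Data.Empty using (⊥; ⊥-elim)
open import Function using (_∘_; id)
open import Function.Bundles using (_⇔_; Equivalence; mk⇔)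
open import Relation.Nullary using (¬_; Dec; yes; no)
open import Relation.Nullary.Decidable using (T?)
open import Data.Nat.Solver using (module +-*-Solver)
open +-*-Solver using (solve; _:*_; _:+_; _:=_; con)
open import Relation.Binary.PropositionalEquality
  using (_≡_; _≢_; refl; sym; trans; cong; cong₂; subst; module ≡-Reasoning)

module _ {A : Set} where

  remove : ∀ {a : A} (xs : List A) → a ∈ xs →
           ∃[ R ] (suc (length R) ≡ length xs × (∀ {e} → e ∈ xs → e ∈ a ∷ R))
  remove (x ∷ xs) (here refl) = xs , refl , id
  remove {a} (x ∷ xs) (there a∈xs) with remove xs a∈xs
  ... | R , len , xs⊆aR = x ∷ R , cong suc len , cover
    where
      cover : ∀ {e} → e ∈ x ∷ xs → e ∈ a ∷ x ∷ R
      cover (here e≡x) = there (here e≡x)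
      cover (there e∈xs) with xs⊆aR e∈xs
      ... | here e≡a = here e≡a
      ... | there e∈R = there (there e∈R)

  notHere : ∀ {a e : A} {R} → e ∈ a ∷ R → e ≢ a → e ∈ R
  notHere (here e≡a) e≢a = ⊥-elim (e≢a e≡a)
  notHere (there e∈R) _ = e∈R

  uniqueBound : ∀ (xs ys : List A) → AllPairs _≢_ xs →
                (∀ {e} → e ∈ xs → e ∈ ys) → length xs ≤ length ys
  uniqueBound [] ys _ _ = z≤n
  uniqueBound (x ∷ xs) ys (x∉xs ∷ unique) xs⊆ys with remove ys (xs⊆ys (here refl))
  ... | R , len , ys⊆xR = subst (suc (length xs) ≤_) len (s≤s (uniqueBound xs R unique xs⊆R))
    where
      xs⊆R : ∀ {e} → e ∈ xs → e ∈ R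
      xs⊆R e∈xs = notHere (ys⊆xR (xs⊆ys (there e∈xs))) (λ e≡x → All.lookup x∉xs e∈xs (sym e≡x))

  splitOff : ∀ (ks : List A) {xs : List A} → AllPairs _≢_ ks → All (_∈ xs) ks →
             ∃[ R ] (length ks + length R ≡ length xs × (∀ {e} → e ∈ xs → e ∈ ks ++ R))
  splitOff [] {xs} _ _ = xs , refl , id
  splitOff (k ∷ ks) {xs} (k∉ks ∷ unique) (k∈xs ∷ ks⊆xs) with remove xs k∈xs
  ... | R₁ , len₁ , xs⊆kR₁ with splitOff ks unique (All.zipWith inR₁ (k∉ks , ks⊆xs))
    where
      inR₁ : ∀ {e} → k ≢ e × e ∈ xs → e ∈ R₁
      inR₁ (k≢e , e∈xs) = notHere (xs⊆kR₁ e∈xs) (λ e≡k → k≢e (sym e≡k))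
  ... | R , len , R₁⊆ksR = R , trans (cong suc len) len₁ , cover
    where
      cover : ∀ {e} → e ∈ xs → e ∈ k ∷ ks ++ R
      cover e∈xs with xs⊆kR₁ e∈xs
      ... | here e≡k = here e≡k
      ... | there e∈R₁ = there (R₁⊆ksR e∈R₁)

  map-≡⇒pointwise : ∀ {B : Set} (f g : A → B) (L : List A) → map f L ≡ map g L →
                    ∀ {e} → e ∈ L → f e ≡ g e
  map-≡⇒pointwise f g (x ∷ L) eq (here refl) = proj₁ (∷-injective eq)
  map-≡⇒pointwise f g (x ∷ L) eq (there e∈L) = map-≡⇒pointwise f g L (proj₂ (∷-injective eq)) e∈L

words : ℕ → List (List Bool)
words 0 = [] ∷ []
words (suc n) = cartesianProductWith _∷_ (true ∷ false ∷ []) (words n)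

length-cartesianProductWith : ∀ {A B C : Set} (f : A → B → C) (xs : List A) (ys : List B) →
  length (cartesianProductWith f xs ys) ≡ length xs * length ys
length-cartesianProductWith f [] ys = refl
length-cartesianProductWith f (x ∷ xs) ys = begin
  length (map (f x) ys ++ cartesianProductWith f xs ys)
    ≡⟨ length-++ (map (f x) ys) ⟩
  length (map (f x) ys) + length (cartesianProductWith f xs ys)
    ≡⟨ cong₂ _+_ (length-map (f x) ys) (length-cartesianProductWith f xs ys) ⟩
  length ys + length xs * length ys ∎
  where open ≡-Reasoning

length-words : ∀ n → length (words n) ≡ 2 ^ n
length-words 0 = refl
length-words (suc n) = begin
  length (words (suc n))               ≡⟨ length-cartesianProductWith _∷_ (true ∷ false ∷ []) (words n) ⟩
  2 * length (words n)                 ≡⟨ cong (2 *_) (length-words n) ⟩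
  2 ^ suc n                            ∎
  where open ≡-Reasoning

∈-words : ∀ {n} (w : List Bool) → length w ≡ n → w ∈ words n
∈-words [] refl = here refl
∈-words (true ∷ w) refl = ∈-cartesianProductWith⁺ _∷_ {xs = true ∷ false ∷ []} (here refl) (∈-words w refl)
∈-words (false ∷ w) refl = ∈-cartesianProductWith⁺ _∷_ {xs = true ∷ false ∷ []} (there (here refl)) (∈-words w refl)

prefixed : List (List Bool) → ℕ → List (List Bool)
prefixed ps m = cartesianProductWith _++_ ps (words m)

length-prefixed : ∀ ps m → length (prefixed ps m) ≡ length ps * 2 ^ m
length-prefixed ps m = trans (length-cartesianProductWith _++_ ps (words m))
                             (cong (length ps *_) (length-words m))

∈-prefixed : ∀ {ps m p} (w : List Bool) → p ∈ ps → length w ≡ m → p ++ w ∈ prefixed ps m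
∈-prefixed w p∈ps len = ∈-cartesianProductWith⁺ _++_ p∈ps (∈-words w len)

-- With three special edges 5 of the 8 prefixes are
-- allowed, with four special edges 9 of the 16; and 5 · 2^m, resp.
-- 9 · 2^m ≤ 10 · 2^m, is the claimed bound 2^(n-1) + 2^(n-3) for n = 3 + m,
-- resp. n = 4 + m.
fan-arith : ∀ N m n → 3 + m ≡ n → suc N ≤ 5 * 2 ^ m → N ≤ 2 ^ (n ∸ 1) + 2 ^ (n ∸ 3) ∸ 1
fan-arith N m _ refl h = subst (λ K → N ≤ K ∸ 1) (five≡4+1 (2 ^ m)) (ℕP.∸-monoˡ-≤ 1 h)
  where
    five≡4+1 : ∀ k → 5 * k ≡ 2 * (2 * k) + k
    five≡4+1 = solve 1 (λ k → con 5 :* k := con 2 :* (con 2 :* k) :+ k) refl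

pair-arith : ∀ N m n → 4 + m ≡ n → suc N ≤ 9 * 2 ^ m → N ≤ 2 ^ (n ∸ 1) + 2 ^ (n ∸ 3) ∸ 1
pair-arith N m _ refl h =
  subst (λ K → N ≤ K ∸ 1) (ten≡8+2 (2 ^ m)) (ℕP.∸-monoˡ-≤ 1 (ℕP.≤-trans h (ℕP.*-monoˡ-≤ (2 ^ m) (ℕP.n≤1+n 9))))
  where
    ten≡8+2 : ∀ k → 10 * k ≡ 2 * (2 * (2 * k)) + 2 * k
    ten≡8+2 = solve 1 (λ k → con 10 :* k := con 2 :* (con 2 :* (con 2 :* k)) :+ con 2 :* k) refl

module Garlands {t} {v : Fin t → ℕ} (E : List (Vertex v × Vertex v)) where

  Pair : Set
  Pair = Vertex v × Vertex v

  _≟P_ : (p q : Pair) → Dec (p ≡ q)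
  _≟P_ = ≡-dec _≟V_ _≟V_

  _∋_ : ESubgraph E → Vertex v → Set
  H ∋ x = vs (proj₁ H) x ≡ true

  Adj : ESubgraph E → Vertex v → Vertex v → Set
  Adj H x y = es (proj₁ H) x y ≡ true

  module _ (H : ESubgraph E) where

    edge-ends : ∀ {x y} → Adj H x y → H ∋ x × H ∋ y × InE E x y
    edge-ends {x} {y} = proj₁ (proj₂ H) x y

    label : Vertex v → ℕ
    label = proj₁ (proj₂ (proj₂ H))

    adj⇔ : ∀ {x y} → H ∋ x → H ∋ y → (Adj H x y ⇔ label x ≢ label y)
    adj⇔ {x} {y} = proj₁ (proj₂ (proj₂ (proj₂ H))) x y

    same-label⇒same-part : ∀ {x y} → H ∋ x → H ∋ y → label x ≡ label y → part x ≡ part y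
    same-label⇒same-part {x} {y} = proj₁ (proj₂ (proj₂ (proj₂ (proj₂ H)))) x y

    two-labels : ∃[ x ] ∃[ y ] (H ∋ x × H ∋ y × label x ≢ label y)
    two-labels = proj₂ (proj₂ (proj₂ (proj₂ (proj₂ H))))

    adjacent : ∀ {x y} → H ∋ x → H ∋ y → label x ≢ label y → Adj H x y
    adjacent x∈H y∈H = Equivalence.from (adj⇔ x∈H y∈H)

    adj-sym : ∀ {x y} → Adj H x y → Adj H y x
    adj-sym xy with edge-ends xy
    ... | x∈H , y∈H , _ = adjacent y∈H x∈H (λ eq → Equivalence.to (adj⇔ x∈H y∈H) xy (sym eq))

    cross-adjacent : ∀ {x y} → H ∋ x → H ∋ y → part x ≢ part y → Adj H x y
    cross-adjacent x∈H y∈H x≁y = adjacent x∈H y∈H (x≁y ∘ same-label⇒same-part x∈H y∈H)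

    has-edge : ∃[ x ] ∃[ y ] Adj H x y
    has-edge with two-labels
    ... | x , y , x∈H , y∈H , x≠y = x , y , adjacent x∈H y∈H x≠y

  member-unique : ∀ {Hs : List (ESubgraph E)} {H H′ : ESubgraph E} {w} →
    AllPairs (λ G K → VertexDisjoint (proj₁ G) (proj₁ K)) Hs →
    H ∈ Hs → H′ ∈ Hs → H ∋ w → H′ ∋ w → H ≡ H′
  member-unique (_ ∷ _) (here refl) (here refl) _ _ = refl
  member-unique {w = w} (H∥ ∷ _) (here refl) (there H′∈) w∈H w∈H′ = ⊥-elim (All.lookup H∥ H′∈ w w∈H w∈H′)
  member-unique {w = w} (H′∥ ∷ _) (there H∈) (here refl) w∈H w∈H′ = ⊥-elim (All.lookup H′∥ H∈ w w∈H′ w∈H)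
  member-unique (_ ∷ disj) (there H∈) (there H′∈) w∈H w∈H′ = member-unique disj H∈ H′∈ w∈H w∈H′

  carriesL : List (ESubgraph E) → Pair → Bool
  carriesL [] p = false
  carriesL (H ∷ Hs) (a , b) = es (proj₁ H) a b ∨ carriesL Hs (a , b)

  carries : Garland E → Pair → Bool
  carries g = carriesL (members g)

  carries-intro : ∀ {Hs H a b} → H ∈ Hs → Adj H a b → carriesL Hs (a , b) ≡ true
  carries-intro {H ∷ Hs} {a = a} {b} (here refl) ab = cong (_∨ carriesL Hs (a , b)) ab
  carries-intro {K ∷ Hs} {a = a} {b} (there H∈) ab with es (proj₁ K) a b
  ... | true = refl
  ... | false = carries-intro H∈ ab

  carries-elim : ∀ Hs {a b} → carriesL Hs (a , b) ≡ true → ∃[ H ] (H ∈ Hs × Adj H a b)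
  carries-elim (H ∷ Hs) {a} {b} c with es (proj₁ H) a b in ab
  ... | true = H , here refl , ab
  ... | false with carries-elim Hs c
  ... | K , K∈ , Kab = K , there K∈ , Kab

  carries-sym : ∀ Hs a b → carriesL Hs (a , b) ≡ carriesL Hs (b , a)
  carries-sym [] a b = refl
  carries-sym (H ∷ Hs) a b =
    cong₂ _∨_ (⇔→≡ (mk⇔ (adj-sym H) (adj-sym H))) (carries-sym Hs a b)

  garland-has-edge : ∀ g → ∃[ p ] (p ∈ E × carries g p ≡ true)
  garland-has-edge g with members g in eq
  ... | [] = ⊥-elim (nonempty g eq)
  ... | H ∷ Hs with has-edge H
  ... | x , y , xy with proj₂ (proj₂ (edge-ends H xy))
  ... | inj₁ xy∈E = (x , y) , xy∈E , carries-intro {H ∷ Hs} (here refl) xy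
  ... | inj₂ yx∈E = (y , x) , yx∈E , carries-intro {H ∷ Hs} (here refl) (adj-sym H xy)

  record Agree (g h : Garland E) : Set where
    constructor agreeing
    field agree : ∀ {p} → p ∈ E → carries g p ≡ carries h p
  open Agree

  agree-sym : ∀ {g h} → Agree g h → Agree h g
  agree-sym ag = agreeing (sym ∘ agree ag)

  agree-InE : ∀ {g h a b} → Agree g h → InE E a b → carries g (a , b) ≡ carries h (a , b)
  agree-InE ag (inj₁ ab∈E) = agree ag ab∈E
  agree-InE {g} {h} {a} {b} ag (inj₂ ba∈E) = begin
    carries g (a , b)   ≡⟨ carries-sym (members g) a b ⟩
    carries g (b , a)   ≡⟨ agree ag ba∈E ⟩
    carries h (b , a)   ≡⟨ carries-sym (members h) b a ⟩
    carries h (a , b)   ∎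
    where open ≡-Reasoning

  -- Let g, h agree.  An edge ab of a member H of g, whose endpoint a lies in
  -- the member H′ of h, is an edge of H′: it is an edge of some member of h,
  -- which contains a and so is H′ by disjointness.
  edge-transfer : ∀ {g h H H′ a b} → Agree g h → H ∈ members g → H′ ∈ members h →
                  Adj H a b → H′ ∋ a → Adj H′ a b
  edge-transfer {g} {h} {H} ag H∈g H′∈h ab a∈H′
    with carries-elim (members h)
           (trans (sym (agree-InE ag (proj₂ (proj₂ (edge-ends H ab))))) (carries-intro H∈g ab))
  ... | K , K∈h , Kab with member-unique (disjoint h) K∈h H′∈h (proj₁ (edge-ends K Kab)) a∈H′
  ... | refl = Kab

  -- If members H of g and H′ of h share an edge xy, every vertex w of H lies
  -- in H′: w is adjacent in H to x or to y, and that edge passes to H′.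
  vertex-transfer : ∀ {g h H H′ x y w} → Agree g h → H ∈ members g → H′ ∈ members h →
                    Adj H x y → Adj H′ x y → H ∋ w → H′ ∋ w
  vertex-transfer {H = H} {H′} {x} {y} {w} ag H∈g H′∈h xy xy′ w∈H
    with edge-ends H xy | edge-ends H′ xy′ | label H w ℕP.≟ label H x
  ... | x∈H , _ , _ | x∈H′ , _ , _ | no w≠x =
    proj₁ (proj₂ (edge-ends H′ (edge-transfer ag H∈g H′∈h (adjacent H x∈H w∈H (w≠x ∘ sym)) x∈H′)))
  ... | x∈H , y∈H , _ | _ , y∈H′ , _ | yes w≡x =
    proj₁ (proj₂ (edge-ends H′ (edge-transfer ag H∈g H′∈h (adjacent H y∈H w∈H y≠w) y∈H′)))
    where
      y≠w : label H y ≢ label H w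
      y≠w y≡w = Equivalence.to (adj⇔ H x∈H y∈H) xy (trans (sym w≡x) (sym y≡w))

  member-match : ∀ {g h H} → Agree g h → H ∈ members g →
                 ∃[ H′ ] (H′ ∈ members h × proj₁ H′ ≈G proj₁ H)
  member-match {g} {h} {H} ag H∈g with has-edge H
  ... | x , y , xy with carries-elim (members h)
                         (trans (sym (agree-InE ag (proj₂ (proj₂ (edge-ends H xy))))) (carries-intro H∈g xy))
  ... | H′ , H′∈h , xy′ = H′ , H′∈h , same-vertices , same-edges
    where
      ga = agree-sym ag
      same-vertices : ∀ w → vs (proj₁ H′) w ≡ vs (proj₁ H) w
      same-vertices w = ⇔→≡ (mk⇔ (vertex-transfer ga H′∈h H∈g xy′ xy)
                                 (vertex-transfer ag H∈g H′∈h xy xy′))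
      same-edges : ∀ a b → es (proj₁ H′) a b ≡ es (proj₁ H) a b
      same-edges a b = ⇔→≡ (mk⇔
        (λ ab′ → edge-transfer ga H′∈h H∈g ab′
                   (vertex-transfer ga H′∈h H∈g xy′ xy (proj₁ (edge-ends H′ ab′))))
        (λ ab → edge-transfer ag H∈g H′∈h ab
                   (vertex-transfer ag H∈g H′∈h xy xy′ (proj₁ (edge-ends H ab)))))

  agree⇒same : ∀ {g h} → Agree g h → SameGarland g h
  agree⇒same {g} {h} ag G = mk⇔ (into ag) (into (agree-sym ag))
    where
      into : ∀ {g h} → Agree g h → InGarland G g → InGarland G h
      into ag G∈g with find G∈g
      ... | H , H∈g , (H≈G-vs , H≈G-es) with member-match ag H∈g
      ... | H′ , H′∈h , (H′≈H-vs , H′≈H-es) =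
        lose H′∈h ((λ w → trans (H′≈H-vs w) (H≈G-vs w)) , (λ a b → trans (H′≈H-es a b) (H≈G-es a b)))

  listed : ∀ {x y} → InE E x y → Pair
  listed {x} {y} (inj₁ _) = x , y
  listed {x} {y} (inj₂ _) = y , x

  listed∈E : ∀ {x y} (i : InE E x y) → listed i ∈ E
  listed∈E (inj₁ xy∈E) = xy∈E
  listed∈E (inj₂ yx∈E) = yx∈E

  carries-listed : ∀ g {x y} (i : InE E x y) → carries g (listed i) ≡ carries g (x , y)
  carries-listed g (inj₁ _) = refl
  carries-listed g {x} {y} (inj₂ _) = carries-sym (members g) y x

  -- The two edges xy, yz of a Ξ₂-subgraph lie in no common garland: they
  -- would lie in the member containing y, which then contains x and z, from
  -- different parts of K(v), and hence the edge xz ∉ E.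
  xi2-conflict : ∀ {x y z} → IsXi2 E x y z → ∀ g →
                 carries g (x , y) ≡ true → carries g (y , z) ≡ true → ⊥
  xi2-conflict (_ , _ , x≁z , _ , _ , xz∉E) g xy yz
    with carries-elim (members g) xy | carries-elim (members g) yz
  ... | H , H∈g , Hxy | H′ , H′∈g , H′yz with edge-ends H Hxy | edge-ends H′ H′yz
  ... | x∈H , y∈H , _ | y∈H′ , z∈H′ , _ with member-unique (disjoint g) H′∈g H∈g y∈H′ y∈H
  ... | refl = xz∉E (proj₂ (proj₂ (edge-ends H (cross-adjacent H x∈H z∈H′ x≁z))))

  xi2-listed-distinct : ∀ {x y z} → IsXi2 E x y z → (i : InE E x y) (j : InE E y z) →
                        listed i ≢ listed j
  xi2-listed-distinct (x≁y , _ , _) (inj₁ _) (inj₁ _) eq = x≁y (cong (part ∘ proj₁) eq)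
  xi2-listed-distinct (_ , _ , x≁z , _) (inj₁ _) (inj₂ _) eq = x≁z (cong (part ∘ proj₁) eq)
  xi2-listed-distinct (_ , _ , x≁z , _) (inj₂ _) (inj₁ _) eq = x≁z (cong (part ∘ proj₂) eq)
  xi2-listed-distinct (_ , y≁z , _) (inj₂ _) (inj₂ _) eq = y≁z (cong (part ∘ proj₁) eq)

  SamePair : Pair → Pair → Pair → Pair → Set
  SamePair p q p′ q′ = (p ≡ p′ × q ≡ q′) ⊎ (p ≡ q′ × q ≡ p′)

  ∨-samePair : ∀ (f : Pair → Bool) {p q p′ q′} → SamePair p q p′ q′ → f p ∨ f q ≡ f p′ ∨ f q′
  ∨-samePair f (inj₁ (refl , refl)) = refl
  ∨-samePair f {p} {q} (inj₂ (refl , refl)) = ∨-comm (f p) (f q)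

  ends : Vertex v → Pair → Bool
  ends w (c , d) = (w == c) ∨ (w == d)

  joins : Vertex v → Vertex v → Pair → Bool
  joins a b (c , d) = pairEq a b c d

  ends-listed : ∀ {x y} (i : InE E x y) w → ends w (listed i) ≡ (w == x) ∨ (w == y)
  ends-listed (inj₁ _) w = refl
  ends-listed {x} {y} (inj₂ _) w = ∨-comm (w == y) (w == x)

  joins-listed : ∀ {x y} (i : InE E x y) a b → joins a b (listed i) ≡ pairEq a b x y
  joins-listed (inj₁ _) a b = refl
  joins-listed {x} {y} (inj₂ _) a b = ∨-comm ((a == y) ∧ (b == x)) ((a == x) ∧ (b == y))

  ∨-overlap : ∀ a b c → a ∨ (b ∨ c) ≡ (a ∨ b) ∨ (b ∨ c)
  ∨-overlap false false c = refl
  ∨-overlap false true c = refl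
  ∨-overlap true b c = refl

  path-vs : ∀ {x y z} (i : InE E x y) (j : InE E y z) w →
            vs (pathGraph x y z) w ≡ ends w (listed i) ∨ ends w (listed j)
  path-vs {x} {y} {z} i j w =
    trans (∨-overlap (w == x) (w == y) (w == z)) (sym (cong₂ _∨_ (ends-listed i w) (ends-listed j w)))

  path-es : ∀ {x y z} (i : InE E x y) (j : InE E y z) a b →
            es (pathGraph x y z) a b ≡ joins a b (listed i) ∨ joins a b (listed j)
  path-es i j a b = sym (cong₂ _∨_ (joins-listed i a b) (joins-listed j a b))

  path-cong : ∀ {x y z x′ y′ z′} (i : InE E x y) (j : InE E y z) (i′ : InE E x′ y′) (j′ : InE E y′ z′) →
              SamePair (listed i) (listed j) (listed i′) (listed j′) →
              pathGraph x y z ≈G pathGraph x′ y′ z′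
  path-cong i j i′ j′ same =
    (λ w → trans (path-vs i j w) (trans (∨-samePair (ends w) same) (sym (path-vs i′ j′ w)))) ,
    (λ a b → trans (path-es i j a b) (trans (∨-samePair (joins a b) same) (sym (path-es i′ j′ a b))))

  Exclusive : Pair → Pair → Set
  Exclusive p q = ∀ g → carries g p ≡ true → carries g q ≡ true → ⊥

  exclusive-flip : ∀ {p q} → Exclusive p q → Exclusive q p
  exclusive-flip excl g q∈g p∈g = excl g p∈g q∈g

  xi2-exclusive : ∀ {x y z} (ξ : IsXi2 E x y z) (i : InE E x y) (j : InE E y z) →
                  Exclusive (listed i) (listed j)
  xi2-exclusive ξ i j g xy yz =
    xi2-conflict ξ g (trans (sym (carries-listed g i)) xy) (trans (sym (carries-listed g j)) yz)

  exclusive-T : ∀ {b₁ b₂ : Bool} → (b₁ ≡ true → b₂ ≡ true → ⊥) → T (not (b₁ ∧ b₂))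
  exclusive-T {false} _ = _
  exclusive-T {true} {false} _ = _
  exclusive-T {true} {true} both = both refl refl

  -- A garland g is encoded by its word: the values of carries g
  -- along a listing of E.
  module Counting (gs : List (Garland E)) (distinct : AllPairs (λ g h → ¬ SameGarland g h) gs) where

    countByPrefix : (ks : List Pair) → AllPairs _≢_ ks → All (_∈ E) ks →
      (ok : List Bool → Bool) → T (ok (map (λ _ → false) ks)) → (∀ g → T (ok (map (carries g) ks))) →
      ∃[ m ] (length ks + m ≡ length E ×
              suc (length gs) ≤ length (filter (T? ∘ ok) (words (length ks))) * 2 ^ m)
    countByPrefix ks ks-distinct ks⊆E ok ok-zero ok-garland with splitOff ks ks-distinct ks⊆E
    ... | R , len , E⊆L = length R , len , bound
      where
        OK = filter (T? ∘ ok) (words (length ks))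

        word : (Pair → Bool) → List Bool
        word f = map f (ks ++ R)

        zero-word = word (λ _ → false)
        garland-words = map (word ∘ carries) gs

        word∈ : ∀ f → T (ok (map f ks)) → word f ∈ prefixed OK (length R)
        word∈ f okf = subst (_∈ prefixed OK (length R)) (sym (map-++ f ks R))
          (∈-prefixed (map f R) (∈-filter⁺ (T? ∘ ok) (∈-words (map f ks) (length-map f ks)) okf)
                      (length-map f R))

        all-in : ∀ {w} → w ∈ zero-word ∷ garland-words → w ∈ prefixed OK (length R)
        all-in (here refl) = word∈ (λ _ → false) ok-zero
        all-in (there w∈) with ∈-map⁻ (word ∘ carries) w∈
        ... | g , _ , refl = word∈ (carries g) (ok-garland g)

        nonzero : ∀ g → zero-word ≢ word (carries g)
        nonzero g eq with garland-has-edge g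
        ... | p , p∈E , p∈g with trans (map-≡⇒pointwise (λ _ → false) (carries g) (ks ++ R) eq (E⊆L p∈E)) p∈g
        ... | ()

        injective : ∀ {g h} → ¬ SameGarland g h → word (carries g) ≢ word (carries h)
        injective {g} {h} g≠h eq =
          g≠h (agree⇒same {g} {h} (agreeing (map-≡⇒pointwise (carries g) (carries h) (ks ++ R) eq ∘ E⊆L)))

        words-distinct : AllPairs _≢_ (zero-word ∷ garland-words)
        words-distinct = AllP.map⁺ (All.universal nonzero gs)
                       ∷ AllPairsP.map⁺ (AllPairs.map (λ {g} {h} → injective {g} {h}) distinct)

        bound : suc (length gs) ≤ length OK * 2 ^ length R
        bound = begin
          suc (length gs)                        ≡⟨ cong suc (sym (length-map (word ∘ carries) gs)) ⟩
          length (zero-word ∷ garland-words)     ≤⟨ uniqueBound _ _ words-distinct all-in ⟩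
          length (prefixed OK (length R))        ≡⟨ length-prefixed OK (length R) ⟩
          length OK * 2 ^ length R               ∎
          where open ℕP.≤-Reasoning

    Bound : Set
    Bound = length gs ≤ 2 ^ (length E ∸ 1) + 2 ^ (length E ∸ 3) ∸ 1

    fan : List Bool → Bool
    fan (a ∷ b ∷ c ∷ []) = not (a ∧ b) ∧ not (a ∧ c)
    fan _ = false

    fan-count : length (filter (T? ∘ fan) (words 3)) ≡ 5
    fan-count = refl

    fanBound : ∀ {a b c} → a ∈ E → b ∈ E → c ∈ E → a ≢ b → a ≢ c → b ≢ c →
               Exclusive a b → Exclusive a c → Bound
    fanBound {a} {b} {c} a∈E b∈E c∈E a≢b a≢c b≢c ab ac =
      let m , len , count = countByPrefix (a ∷ b ∷ c ∷ []) ((a≢b ∷ a≢c ∷ []) ∷ (b≢c ∷ []) ∷ [] ∷ [])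
                              (a∈E ∷ b∈E ∷ c∈E ∷ []) fan _
                              (λ g → Equivalence.from T-∧ (exclusive-T (ab g) , exclusive-T (ac g)))
      in fan-arith (length gs) m (length E) len
           (subst (λ k → suc (length gs) ≤ k * 2 ^ m) fan-count count)

    pair : List Bool → Bool
    pair (a ∷ b ∷ c ∷ d ∷ []) = not (a ∧ b) ∧ not (c ∧ d)
    pair _ = false

    pair-count : length (filter (T? ∘ pair) (words 4)) ≡ 9
    pair-count = refl

    pairBound : ∀ {a b c d} → a ∈ E → b ∈ E → c ∈ E → d ∈ E →
                a ≢ b → a ≢ c → a ≢ d → b ≢ c → b ≢ d → c ≢ d →
                Exclusive a b → Exclusive c d → Bound
    pairBound {a} {b} {c} {d} a∈E b∈E c∈E d∈E a≢b a≢c a≢d b≢c b≢d c≢d ab cd =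
      let m , len , count = countByPrefix (a ∷ b ∷ c ∷ d ∷ [])
                              ((a≢b ∷ a≢c ∷ a≢d ∷ []) ∷ (b≢c ∷ b≢d ∷ []) ∷ (c≢d ∷ []) ∷ [] ∷ [])
                              (a∈E ∷ b∈E ∷ c∈E ∷ d∈E ∷ []) pair _
                              (λ g → Equivalence.from T-∧ (exclusive-T (ab g) , exclusive-T (cd g)))
      in pair-arith (length gs) m (length E) len
           (subst (λ k → suc (length gs) ≤ k * 2 ^ m) pair-count count)

    -- Two exclusive pairs {a , b}, {c , d} of listed edges which are
    -- different as unordered pairs either share an edge or are disjoint.
    twoConflicts : ∀ {a b c d} → a ∈ E → b ∈ E → c ∈ E → d ∈ E → a ≢ b → c ≢ d →
                   ¬ SamePair a b c d → Exclusive a b → Exclusive c d → Bound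
    twoConflicts {a} {b} {c} {d} a∈E b∈E c∈E d∈E a≢b c≢d different ab cd
      with a ≟P c | a ≟P d | b ≟P c | b ≟P d
    ... | yes refl | _ | _ | _ =
      fanBound a∈E b∈E d∈E a≢b c≢d (λ b≡d → different (inj₁ (refl , b≡d))) ab cd
    ... | no _ | yes refl | _ | _ =
      fanBound a∈E b∈E c∈E a≢b (c≢d ∘ sym) (λ b≡c → different (inj₂ (refl , b≡c))) ab (exclusive-flip cd)
    ... | no a≢c | no a≢d | yes refl | _ =
      fanBound b∈E a∈E d∈E (a≢b ∘ sym) c≢d a≢d (exclusive-flip ab) cd
    ... | no a≢c | no a≢d | no _ | yes refl =
      fanBound b∈E a∈E c∈E (a≢b ∘ sym) (c≢d ∘ sym) a≢c (exclusive-flip ab) (exclusive-flip cd)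
    ... | no a≢c | no a≢d | no b≢c | no b≢d =
      pairBound a∈E b∈E c∈E d∈E a≢b a≢c a≢d b≢c b≢d c≢d ab cd

    xi2Bound : ∀ {x y z x′ y′ z′} → IsXi2 E x y z → IsXi2 E x′ y′ z′ →
               ¬ (pathGraph x y z ≈G pathGraph x′ y′ z′) → Bound
    xi2Bound ξ@(_ , _ , _ , i , j , _) ξ′@(_ , _ , _ , i′ , j′ , _) distinct-paths =
      twoConflicts (listed∈E i) (listed∈E j) (listed∈E i′) (listed∈E j′)
        (xi2-listed-distinct ξ i j) (xi2-listed-distinct ξ′ i′ j′)
        (distinct-paths ∘ path-cong i j i′ j′)
        (xi2-exclusive ξ i j) (xi2-exclusive ξ′ i′ j′)

corollary1 : ∀ {t} (v : Fin t → ℕ) → (∀ i → 1 ≤ v i) →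
    (E : List (Vertex v × Vertex v)) → IsEdgeSet E →
    TwoDistinctXi2 E →
    (gs : List (Garland E)) → AllPairs (λ g h → ¬ SameGarland g h) gs →
    length gs ≤ 2 ^ (length E ∸ 1) + 2 ^ (length E ∸ 3) ∸ 1
corollary1 v _ E _ (_ , _ , _ , _ , _ , _ , ξ , ξ′ , distinct-paths) gs distinct =
  Garlands.Counting.xi2Bound E gs distinct ξ ξ′ distinct-paths
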